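{- For nonnegative integers $b_1,\ldots,b_k$, let $|b|=b_1+\cdots+b_k$ and let $w(b_k,\ldots,b_1)\in S_{|b|}$ be the associated layered permutation. Then $$\Upsilon_{w(b_k,\ldots,b_1)} = \Upsilon_{w(b_k,\ldots,b_2)}\cdot F(|b|-b_1,\,b_1).$$
   Context: For $w\in S_n$ of length $\ell=\ell(w)$, let $R(w)$ be the set of reduced words $(a_1,\ldots,a_\ell)$ of $w$ (so $w=s_{a_1}\cdots s_{a_\ell}$ with $s_i=(i,i+1)$), and $\Upsilon_w := \mathfrak{S}_w(1,\ldots,1)=\frac{1}{\ell!}\sum_{(a_1,\ldots,a_\ell)\in R(w)} a_1\cdots a_\ell$. The layered permutation $w(b_k,\ldots,b_1)\in S_{|b|}$ is, in one-line notation, $(b_k,\ldots,1,\ b_k+b_{k-1},\ldots,b_k+1,\ \ldots,\ |b|,\ldots,|b|-b_1+1)$: decreasing blocks of consecutive values of sizes $b_k,\ldots,b_1$ from left to right. For $u\in S_p$, $1^m\times u\in S_{m+p}$ denotes the permutation $1\,2\cdots m\,(m+u_1)\cdots(m+u_p)$. Let $w_0^{(p)}=(p,p-1,\ldots,1)\in S_p$ and $F(m,p):=\Upsilon_{1^m\times w_0^{(p)}}$. -}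

module Defs where

open import Data.Nat using (ℕ; zero; suc; _+_; _∸_; _<ᵇ_; _!; NonZero)
open import Data.Nat.Properties using (_!≢0)
open import Data.Bool using (if_then_else_)
open import Data.Nat.ListAction using (sum; product)
open import Data.List using (List; []; _∷_; _++_; map; length; upTo; downFrom; filter; concatMap; foldl)
open import Data.List.Properties using (≡-dec)
import Data.Nat as ℕ
open import Data.Integer using (+_)
open import Data.Rational using (ℚ; _/_)
open import Relation.Binary.PropositionalEquality using (_≡_)
open import Relation.Nullary using (Dec)

-- Permutations of S_n are represented in one-line notation as lists
-- (w(1), ..., w(n)) of the values 1..n.

idPerm : ℕ → List ℕ
idPerm n = map suc (upTo n)

-- right multiplication by s_a = (a, a+1): swaps positions a and a+1 (1-indexed)
swapAt : ℕ → List ℕ → List ℕ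
swapAt zero l = l
swapAt (suc zero) (x ∷ y ∷ r) = y ∷ x ∷ r
swapAt (suc zero) l = l
swapAt (suc (suc a)) [] = []
swapAt (suc (suc a)) (x ∷ r) = x ∷ swapAt (suc a) r

-- the permutation s_{a_1} ... s_{a_l} in S_n, one-line notation
wordPerm : ℕ → List ℕ → List ℕ
wordPerm n as = foldl (λ w a → swapAt a w) (idPerm n) as

inv : List ℕ → ℕ
inv [] = 0
inv (x ∷ r) = sum (map (λ y → if y <ᵇ x then 1 else 0) r) + inv r

words : ℕ → ℕ → List (List ℕ)
words zero n = [] ∷ []
words (suc l) n = concatMap (λ a → map (a ∷_) (words l n)) (map suc (upTo (n ∸ 1)))

_≟L_ : (u v : List ℕ) → Dec (u ≡ v)
_≟L_ = ≡-dec ℕ._≟_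

reducedWords : List ℕ → List (List ℕ)
reducedWords w = filter (λ as → wordPerm (length w) as ≟L w) (words (inv w) (length w))

Υ : List ℕ → ℚ
Υ w = (+ sum (map product (reducedWords w))) / (inv w !)
  where instance _ = inv w !≢0

-- layered permutation: layered (b₁ ∷ b₂ ∷ ... ∷ b_k ∷ []) = w(b_k, ..., b_1),
-- blocks of sizes b_k, ..., b_1 from left to right
layered : List ℕ → List ℕ
layered [] = []
layered (b ∷ bs) = layered bs ++ map (λ i → sum bs + suc i) (downFrom b)

w0 : ℕ → List ℕ
w0 p = map suc (downFrom p)

oneTimes : ℕ → List ℕ → List ℕ
oneTimes m u = idPerm m ++ map (λ x → m + x) u

F : ℕ → ℕ → ℚ
F m p = Υ (oneTimes m (w0 p))

module Submission where

-- Let u ∈ S_m and let v list the values m+1, …, m+p in some order.  Every reduced word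
-- of u ⊕ v = u ++ v is a shuffle of a reduced word of u (letters < m) and a reduced word
-- of v (letters > m); the letter m never occurs.  We make this precise with weighted path
-- counts: paths k r l x w sums ∏ (k + aᵢ) over the words a₁⋯a_l in the letters 1..r taking
-- x to w, and the numerator N(w) of Υ_w is a path count from the identity.

open import Defs
open import Data.Nat using (ℕ; zero; suc; _+_; _∸_; pred; _<_; _≤_; z≤n; s≤s; z<s; _<?_; _≤?_; _!; NonZero)
  renaming (_*_ to _·_)
open import Data.Nat.Properties
open import Data.Nat.Tactic.RingSolver using (solve-∀)
open import Data.Nat.ListAction using (sum; product)
open import Data.Nat.ListAction.Properties using (sum-++; sum-↭)
open import Data.List using (List; []; _∷_; _++_; map; length; upTo; downFrom; applyUpTo; filter; concatMap; foldl)
open import Data.List.Properties using (length-++; length-map; length-upTo; length-downFrom; length-applyUpTo; map-++; map-upTo; map-∘; filter-++; ∷-injective)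
open import Data.List.Relation.Unary.All as All using (All; []; _∷_)
open import Data.List.Relation.Unary.All.Properties using (++⁺; map⁺; applyUpTo⁺₁; applyDownFrom⁺₁)
open import Data.List.Relation.Binary.Permutation.Propositional using (_↭_; ↭-refl; swap)
import Data.List.Relation.Binary.Permutation.Propositional.Properties as ↭
open import Data.Bool using (if_then_else_)
open import Data.Product using (_×_; _,_; proj₁; proj₂)
open import Data.Sum using (_⊎_; inj₁; inj₂)
open import Data.Empty using (⊥; ⊥-elim)
open import Relation.Nullary using (Dec; yes; no; does; ¬_)
open import Relation.Nullary.Decidable using (dec-true; dec-false; _×-dec_)
open import Relation.Binary.Definitions using (Decidable)
open import Relation.Binary.PropositionalEquality
open import Function using (_∘_; id)
import Data.Integer as ℤ
import Data.Integer.Properties as ℤ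
open import Data.Rational using (_/_; _*_; fromℚᵘ)
open import Data.Rational.Properties using (toℚᵘ-injective; toℚᵘ-fromℚᵘ; toℚᵘ-homo-*; fromℚᵘ-cong)
import Data.Rational.Unnormalised as ℚᵘ
import Data.Rational.Unnormalised.Properties as ℚᵘ

Σ< : ℕ → (ℕ → ℕ) → ℕ
Σ< zero    h = 0
Σ< (suc r) h = h 0 + Σ< r (h ∘ suc)

Σ<-cong< : ∀ r {h g : ℕ → ℕ} → (∀ i → i < r → h i ≡ g i) → Σ< r h ≡ Σ< r g
Σ<-cong< zero    e = refl
Σ<-cong< (suc r) e = cong₂ _+_ (e 0 z<s) (Σ<-cong< r (λ i i<r → e (suc i) (s≤s i<r)))

Σ<-cong : ∀ r {h g : ℕ → ℕ} → (∀ i → h i ≡ g i) → Σ< r h ≡ Σ< r g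
Σ<-cong r e = Σ<-cong< r (λ i _ → e i)

Σ<-zero : ∀ r {h : ℕ → ℕ} → (∀ i → h i ≡ 0) → Σ< r h ≡ 0
Σ<-zero zero    e = refl
Σ<-zero (suc r) e = cong₂ _+_ (e 0) (Σ<-zero r (e ∘ suc))

+-interchange : ∀ a b c d → (a + b) + (c + d) ≡ (a + c) + (b + d)
+-interchange = solve-∀

Σ<-+ : ∀ r (f g : ℕ → ℕ) → Σ< r (λ i → f i + g i) ≡ Σ< r f + Σ< r g
Σ<-+ zero    f g = refl
Σ<-+ (suc r) f g =
  trans (cong (f 0 + g 0 +_) (Σ<-+ r (f ∘ suc) (g ∘ suc))) (+-interchange (f 0) (g 0) _ _)

Σ<-*ˡ : ∀ r c (f : ℕ → ℕ) → c · Σ< r f ≡ Σ< r (λ i → c · f i)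
Σ<-*ˡ zero    c f = *-zeroʳ c
Σ<-*ˡ (suc r) c f = trans (*-distribˡ-+ c (f 0) _) (cong (c · f 0 +_) (Σ<-*ˡ r c (f ∘ suc)))

Σ<-*ʳ : ∀ r (f : ℕ → ℕ) c → Σ< r f · c ≡ Σ< r (λ i → f i · c)
Σ<-*ʳ zero    f c = refl
Σ<-*ʳ (suc r) f c = trans (*-distribʳ-+ c (f 0) _) (cong (f 0 · c +_) (Σ<-*ʳ r (f ∘ suc) c))

Σ<-split : ∀ m n (h : ℕ → ℕ) → Σ< (m + n) h ≡ Σ< m h + Σ< n (λ i → h (m + i))
Σ<-split zero    n h = refl
Σ<-split (suc m) n h = trans (cong (h 0 +_) (Σ<-split m n (h ∘ suc))) (sym (+-assoc (h 0) _ _))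

-- The summand sitting between a range of m ∸ 1 and a range of p ∸ 1 summands in a range
-- of m + p ∸ 1 summands: it is present exactly when both m and p are positive.
boundary : ℕ → ℕ → (ℕ → ℕ) → ℕ
boundary (suc m) (suc p) h = h m
boundary _       _       h = 0

-- Splitting the m + p − 1 first letters of a block list into those acting on the first
-- block, the letter m, and those acting on the second block.
Σ<-around : ∀ m p (h : ℕ → ℕ) →
  Σ< (m + p ∸ 1) h ≡ Σ< (m ∸ 1) h + boundary m p h + Σ< (p ∸ 1) (λ i → h (m + i))
Σ<-around zero    p       h = refl
Σ<-around (suc m) zero    h =
  trans (cong (λ n → Σ< n h) (+-identityʳ m)) (sym (trans (+-identityʳ _) (+-identityʳ _)))
Σ<-around (suc m) (suc p) h = begin
  Σ< (m + suc p) h                                        ≡⟨ Σ<-split m (suc p) h ⟩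
  Σ< m h + (h (m + 0) + Σ< p (λ i → h (m + suc i)))
    ≡⟨ cong₂ (λ s t → Σ< m h + (h s + t)) (+-identityʳ m) (Σ<-cong p (λ i → cong h (+-suc m i))) ⟩
  Σ< m h + (h m + Σ< p (λ i → h (suc m + i)))             ≡⟨ sym (+-assoc (Σ< m h) _ _) ⟩
  Σ< m h + h m + Σ< p (λ i → h (suc m + i))               ∎
  where open ≡-Reasoning

𝟙 : {A : Set} → Dec A → ℕ
𝟙 d = if does d then 1 else 0

𝟙-yes : {A : Set} (d : Dec A) → A → 𝟙 d ≡ 1
𝟙-yes d a rewrite dec-true d a = refl

𝟙-no : {A : Set} (d : Dec A) → ¬ A → 𝟙 d ≡ 0
𝟙-no d ¬a rewrite dec-false d ¬a = refl

𝟙-exclusive : {A B : Set} (a? : Dec A) (b? : Dec B) → (A → B → ⊥) → 𝟙 a? + 𝟙 b? ≤ 1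
𝟙-exclusive (yes a) (yes b) excl = ⊥-elim (excl a b)
𝟙-exclusive (yes a) (no _)  excl = s≤s z≤n
𝟙-exclusive (no _)  (yes b) excl = s≤s z≤n
𝟙-exclusive (no _)  (no _)  excl = z≤n

-- The offset k lets a block sitting after k other entries use its own
-- letters 1..r while being weighted by its letters k+1..k+r in the whole permutation.
paths : (k r l : ℕ) → List ℕ → List ℕ → ℕ
paths k r zero    x w = 𝟙 (x ≟L w)
paths k r (suc l) x w = Σ< r (λ i → (k + suc i) · paths k r l (swapAt (suc i) x) w)

act : List ℕ → List ℕ → List ℕ
act x as = foldl (λ v a → swapAt a v) x as

landingWeight : List ℕ → List ℕ → List (List ℕ) → ℕ
landingWeight x w W = sum (map product (filter (λ as → act x as ≟L w) W))

landingWeight-++ : ∀ x w U V → landingWeight x w (U ++ V) ≡ landingWeight x w U + landingWeight x w V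
landingWeight-++ x w U V = begin
  sum (map product (filter P? (U ++ V)))
    ≡⟨ cong (sum ∘ map product) (filter-++ P? U V) ⟩
  sum (map product (filter P? U ++ filter P? V))
    ≡⟨ cong sum (map-++ product (filter P? U) _) ⟩
  sum (map product (filter P? U) ++ map product (filter P? V))
    ≡⟨ sum-++ (map product (filter P? U)) _ ⟩
  landingWeight x w U + landingWeight x w V ∎
  where
  open ≡-Reasoning
  P? = λ as → act x as ≟L w

landingWeight-prefix : ∀ x w a W → landingWeight x w (map (a ∷_) W) ≡ a · landingWeight (swapAt a x) w W
landingWeight-prefix x w a []       = sym (*-zeroʳ a)
landingWeight-prefix x w a (as ∷ W) with act (swapAt a x) as ≟L w
... | yes _ = trans (cong (a · product as +_) (landingWeight-prefix x w a W))
                    (sym (*-distribˡ-+ a (product as) _))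
... | no _  = landingWeight-prefix x w a W

landingWeight-byFirstLetter : ∀ x w W L →
  landingWeight x w (concatMap (λ a → map (a ∷_) W) L) ≡ sum (map (λ a → a · landingWeight (swapAt a x) w W) L)
landingWeight-byFirstLetter x w W []      = refl
landingWeight-byFirstLetter x w W (a ∷ L) =
  trans (landingWeight-++ x w (map (a ∷_) W) _)
        (cong₂ _+_ (landingWeight-prefix x w a W) (landingWeight-byFirstLetter x w W L))

sum-applyUpTo : ∀ (f g : ℕ → ℕ) r → sum (map f (applyUpTo g r)) ≡ Σ< r (f ∘ g)
sum-applyUpTo f g zero    = refl
sum-applyUpTo f g (suc r) = cong (f (g 0) +_) (sum-applyUpTo f (g ∘ suc) r)

landingWeight-words : ∀ n l x w → landingWeight x w (words l n) ≡ paths 0 (n ∸ 1) l x w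
landingWeight-words n zero    x w with x ≟L w
... | yes _ = refl
... | no _  = refl
landingWeight-words n (suc l) x w = begin
  landingWeight x w (concatMap (λ a → map (a ∷_) (words l n)) (map suc (upTo (n ∸ 1))))
    ≡⟨ landingWeight-byFirstLetter x w (words l n) (map suc (upTo (n ∸ 1))) ⟩
  sum (map f (map suc (upTo (n ∸ 1))))
    ≡⟨ cong (sum ∘ map f) (map-upTo suc (n ∸ 1)) ⟩
  sum (map f (applyUpTo suc (n ∸ 1)))
    ≡⟨ sum-applyUpTo f suc (n ∸ 1) ⟩
  Σ< (n ∸ 1) (f ∘ suc)
    ≡⟨ Σ<-cong (n ∸ 1) (λ i → cong (suc i ·_) (landingWeight-words n l (swapAt (suc i) x) w)) ⟩
  paths 0 (n ∸ 1) (suc l) x w ∎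
  where
  open ≡-Reasoning
  f : ℕ → ℕ
  f a = a · landingWeight (swapAt a x) w (words l n)

numerator : List ℕ → ℕ
numerator w = sum (map product (reducedWords w))

numerator-paths : ∀ n w → length w ≡ n → numerator w ≡ paths 0 (n ∸ 1) (inv w) (idPerm n) w
numerator-paths _ w refl = landingWeight-words (length w) (inv w) (idPerm (length w)) w

-- With R = "is larger than" this is the inversion number inv; other relations R give the
-- potentials used to show that certain path counts vanish.
count : {R : ℕ → ℕ → Set} → Decidable R → ℕ → List ℕ → ℕ
count R? x ys = sum (map (λ y → 𝟙 (R? x y)) ys)

invBy : {R : ℕ → ℕ → Set} → Decidable R → List ℕ → ℕ
invBy R? []       = 0
invBy R? (x ∷ ys) = count R? x ys + invBy R? ys

descent? : Decidable (λ x y → y < x)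
descent? x y = y <? x

inv≡invBy : ∀ l → inv l ≡ invBy descent? l
inv≡invBy []      = refl
inv≡invBy (x ∷ l) = cong (count descent? x l +_) (inv≡invBy l)

exchange-arith : ∀ a b c d e → (a + c) + (d + e) + b ≡ (b + d) + (c + e) + a
exchange-arith = solve-∀

module _ {R : ℕ → ℕ → Set} (R? : Decidable R) where

  count-++ : ∀ x ys zs → count R? x (ys ++ zs) ≡ count R? x ys + count R? x zs
  count-++ x ys zs = trans (cong sum (map-++ _ ys zs)) (sum-++ (map _ ys) _)

  count-↭ : ∀ x {ys zs} → ys ↭ zs → count R? x ys ≡ count R? x zs
  count-↭ x p = sum-↭ (↭.map⁺ _ p)

  count-none : ∀ x {ys} → All (λ y → ¬ R x y) ys → count R? x ys ≡ 0
  count-none x []         = refl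
  count-none x (¬r ∷ ¬rs) = cong₂ _+_ (𝟙-no (R? x _) ¬r) (count-none x ¬rs)

  invBy-++ : ∀ ys zs → All (λ y → All (λ z → ¬ R y z) zs) ys → invBy R? (ys ++ zs) ≡ invBy R? ys + invBy R? zs
  invBy-++ []       zs []           = refl
  invBy-++ (y ∷ ys) zs (¬rs ∷ ¬rss) = begin
    count R? y (ys ++ zs) + invBy R? (ys ++ zs)
      ≡⟨ cong₂ _+_ (count-++ y ys zs) (invBy-++ ys zs ¬rss) ⟩
    (count R? y ys + count R? y zs) + (invBy R? ys + invBy R? zs)
      ≡⟨ cong (λ c → (count R? y ys + c) + _) (count-none y ¬rs) ⟩
    (count R? y ys + 0) + (invBy R? ys + invBy R? zs)
      ≡⟨ cong (_+ _) (+-identityʳ (count R? y ys)) ⟩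
    count R? y ys + (invBy R? ys + invBy R? zs)
      ≡⟨ sym (+-assoc (count R? y ys) _ _) ⟩
    invBy R? (y ∷ ys) + invBy R? zs ∎
    where open ≡-Reasoning

  invBy-none : ∀ {P : ℕ → Set} → (∀ {x y} → P x → P y → ¬ R x y) → ∀ {l} → All P l → invBy R? l ≡ 0
  invBy-none excl []         = refl
  invBy-none excl (px ∷ pxs) = cong₂ _+_ (count-none _ (All.map (excl px) pxs)) (invBy-none excl pxs)

  invBy-exchange : ∀ L x z Rs → invBy R? (L ++ z ∷ x ∷ Rs) + 𝟙 (R? x z) ≡ invBy R? (L ++ x ∷ z ∷ Rs) + 𝟙 (R? z x)
  invBy-exchange [] x z Rs =
    exchange-arith (𝟙 (R? z x)) (𝟙 (R? x z)) (count R? z Rs) (count R? x Rs) (invBy R? Rs)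
  invBy-exchange (h ∷ L) x z Rs = begin
    count R? h (L ++ z ∷ x ∷ Rs) + invBy R? (L ++ z ∷ x ∷ Rs) + 𝟙 (R? x z)
      ≡⟨ +-assoc (count R? h (L ++ z ∷ x ∷ Rs)) _ (𝟙 (R? x z)) ⟩
    count R? h (L ++ z ∷ x ∷ Rs) + (invBy R? (L ++ z ∷ x ∷ Rs) + 𝟙 (R? x z))
      ≡⟨ cong₂ _+_ (count-↭ h (↭.++⁺ˡ L (swap z x ↭-refl))) (invBy-exchange L x z Rs) ⟩
    count R? h (L ++ x ∷ z ∷ Rs) + (invBy R? (L ++ x ∷ z ∷ Rs) + 𝟙 (R? z x))
      ≡⟨ sym (+-assoc (count R? h (L ++ x ∷ z ∷ Rs)) _ (𝟙 (R? z x))) ⟩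
    count R? h (L ++ x ∷ z ∷ Rs) + invBy R? (L ++ x ∷ z ∷ Rs) + 𝟙 (R? z x) ∎
    where open ≡-Reasoning

data Adjacent : List ℕ → List ℕ → Set where
  stay     : ∀ {y} → Adjacent y y
  exchange : ∀ L x z R → Adjacent (L ++ x ∷ z ∷ R) (L ++ z ∷ x ∷ R)

cons-adjacent : ∀ h {y y′} → Adjacent y y′ → Adjacent (h ∷ y) (h ∷ y′)
cons-adjacent h stay               = stay
cons-adjacent h (exchange L x z R) = exchange (h ∷ L) x z R

swapAt-adjacent : ∀ a y → Adjacent y (swapAt a y)
swapAt-adjacent zero          y           = stay
swapAt-adjacent (suc zero)    []          = stay
swapAt-adjacent (suc zero)    (x ∷ [])    = stay
swapAt-adjacent (suc zero)    (x ∷ z ∷ r) = exchange [] x z r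
swapAt-adjacent (suc (suc a)) []          = stay
swapAt-adjacent (suc (suc a)) (x ∷ r)     = cons-adjacent x (swapAt-adjacent (suc a) r)

swapAt-↭ : ∀ a y → y ↭ swapAt a y
swapAt-↭ a y = adjacent⇒↭ (swapAt-adjacent a y)
  where
  adjacent⇒↭ : ∀ {y y′} → Adjacent y y′ → y ↭ y′
  adjacent⇒↭ stay               = ↭-refl
  adjacent⇒↭ (exchange L x z R) = ↭.++⁺ˡ L (swap x z ↭-refl)

-- P and Q are compatible if no pair x, z has P z x (a P-pair is created by putting x before z)
-- together with Q x z (a Q-pair is destroyed by doing so).
Compatible : (ℕ → ℕ → Set) → (ℕ → ℕ → Set) → Set
Compatible P Q = ∀ {x z} → P z x → Q x z → ⊥

-- The arithmetic of potential-step: α, β (γ, ε) indicate a P-pair (Q-pair) of the exchanged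
-- neighbours in the two orders, and at most one of β, γ equals 1.
potential-arith : ∀ p p′ q q′ {α β γ ε} → p′ + α ≡ p + β → q′ + γ ≡ q + ε → β + γ ≤ 1 → p′ + q ≤ p + q′ + 1
potential-arith p p′ q q′ {α} {β} {γ} {ε} eP eQ excl = +-cancelʳ-≤ (α + ε) (p′ + q) (p + q′ + 1) (begin
  (p′ + q) + (α + ε)    ≡⟨ +-interchange p′ q α ε ⟩
  (p′ + α) + (q + ε)    ≡⟨ cong₂ _+_ eP (sym eQ) ⟩
  (p + β) + (q′ + γ)    ≡⟨ +-interchange p β q′ γ ⟩
  (p + q′) + (β + γ)    ≤⟨ +-monoʳ-≤ (p + q′) excl ⟩
  (p + q′) + 1          ≤⟨ m≤m+n (p + q′ + 1) (α + ε) ⟩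
  (p + q′ + 1) + (α + ε) ∎)
  where open ≤-Reasoning

-- For compatible P, Q the potential invBy P − invBy Q grows by at most one per adjacent swap.
potential-step : ∀ {P Q} (P? : Decidable P) (Q? : Decidable Q) → Compatible P Q →
  ∀ {y y′} → Adjacent y y′ → invBy P? y′ + invBy Q? y ≤ invBy P? y + invBy Q? y′ + 1
potential-step P? Q? compat stay = m≤m+n _ 1
potential-step P? Q? compat (exchange L x z R) =
  potential-arith (invBy P? (L ++ x ∷ z ∷ R)) (invBy P? (L ++ z ∷ x ∷ R)) (invBy Q? (L ++ x ∷ z ∷ R)) (invBy Q? (L ++ z ∷ x ∷ R))
    (invBy-exchange P? L x z R) (invBy-exchange Q? L x z R) (𝟙-exclusive (P? z x) (Q? x z) compat)

-- One swap changes the potential by at most one, so a gap of more than l + 1 leaves a gap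
-- of more than l after it.
vanish-arith : ∀ Py Py′ Pw Qy Qy′ Qw l → Py + Qw + suc l < Pw + Qy → Py′ + Qy ≤ Py + Qy′ + 1 →
  Py′ + Qw + l < Pw + Qy′
vanish-arith Py Py′ Pw Qy Qy′ Qw l gap step = +-cancelʳ-≤ Qy (suc (Py′ + Qw + l)) (Pw + Qy′) (begin
  suc (Py′ + Qw + l) + Qy         ≡⟨ rearrange₁ Py′ Qy Qw l ⟩
  (Py′ + Qy) + (Qw + suc l)       ≤⟨ +-monoˡ-≤ (Qw + suc l) step ⟩
  (Py + Qy′ + 1) + (Qw + suc l)   ≡⟨ rearrange₂ Py Qy′ Qw l ⟩
  suc (Py + Qw + suc l) + Qy′     ≤⟨ +-monoˡ-≤ Qy′ gap ⟩
  (Pw + Qy) + Qy′                 ≡⟨ rearrange₃ Pw Qy Qy′ ⟩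
  (Pw + Qy′) + Qy                 ∎)
  where
  open ≤-Reasoning
  rearrange₁ : ∀ a b c l → suc (a + c + l) + b ≡ (a + b) + (c + suc l)
  rearrange₁ = solve-∀
  rearrange₂ : ∀ a b c l → (a + b + 1) + (c + suc l) ≡ suc (a + c + suc l) + b
  rearrange₂ = solve-∀
  rearrange₃ : ∀ a b c → (a + b) + c ≡ (a + c) + b
  rearrange₃ = solve-∀

paths-vanish : ∀ {P Q} (P? : Decidable P) (Q? : Decidable Q) → Compatible P Q → ∀ k r l y w →
  invBy P? y + invBy Q? w + l < invBy P? w + invBy Q? y → paths k r l y w ≡ 0
paths-vanish P? Q? compat k r zero y w gap with y ≟L w
... | yes refl = ⊥-elim (<-irrefl (+-identityʳ _) gap)
... | no _     = refl
paths-vanish P? Q? compat k r (suc l) y w gap = Σ<-zero r (λ i → begin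
  (k + suc i) · paths k r l (swapAt (suc i) y) w
    ≡⟨ cong ((k + suc i) ·_) (paths-vanish P? Q? compat k r l (swapAt (suc i) y) w
         (vanish-arith (invBy P? y) _ (invBy P? w) (invBy Q? y) _ (invBy Q? w) l gap (potential-step P? Q? compat (swapAt-adjacent (suc i) y)))) ⟩
  (k + suc i) · 0 ≡⟨ *-zeroʳ (k + suc i) ⟩
  0 ∎)
  where open ≡-Reasoning

-- The empty relation, used as the trivial second potential.
never? : Decidable (λ (x y : ℕ) → ⊥)
never? x y = no (λ ())

invBy-never : ∀ l → invBy never? l ≡ 0
invBy-never l = invBy-none never? {P = λ _ → ℕ} (λ _ _ ()) (All.universal (λ x → x) l)

inv-swapAt : ∀ a y → inv (swapAt a y) ≤ inv y + 1
inv-swapAt a y = begin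
  inv y′                                   ≡⟨ inv≡invBy y′ ⟩
  invBy descent? y′                        ≡⟨ sym (+-identityʳ _) ⟩
  invBy descent? y′ + 0                    ≡⟨ cong (invBy descent? y′ +_) (sym (invBy-never y)) ⟩
  invBy descent? y′ + invBy never? y       ≤⟨ potential-step descent? never? (λ _ ()) (swapAt-adjacent a y) ⟩
  invBy descent? y + invBy never? y′ + 1   ≡⟨ cong₂ (λ s t → s + t + 1) (sym (inv≡invBy y)) (invBy-never y′) ⟩
  inv y + 0 + 1                            ≡⟨ cong (_+ 1) (+-identityʳ (inv y)) ⟩
  inv y + 1                                ∎
  where
  open ≤-Reasoning
  y′ = swapAt a y

paths-short : ∀ k r l x w → inv x + l < inv w → paths k r l x w ≡ 0
paths-short k r l x w short = paths-vanish descent? never? (λ _ ()) k r l x w (begin-strict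
  invBy descent? x + invBy never? w + l  ≡⟨ cong₂ (λ s t → s + t + l) (sym (inv≡invBy x)) (invBy-never w) ⟩
  inv x + 0 + l                          ≡⟨ cong (_+ l) (+-identityʳ (inv x)) ⟩
  inv x + l                              <⟨ short ⟩
  inv w                                  ≡⟨ inv≡invBy w ⟩
  invBy descent? w                       ≡⟨ sym (+-identityʳ _) ⟩
  invBy descent? w + 0                   ≡⟨ cong (invBy descent? w +_) (sym (invBy-never x)) ⟩
  invBy descent? w + invBy never? x      ∎)
  where open ≤-Reasoning

Crossing : ℕ → ℕ → ℕ → Set
Crossing m x y = m < x × y ≤ m

crossing? : ∀ m → Decidable (Crossing m)
crossing? m x y = (m <? x) ×-dec (y ≤? m)

descent-crossing-compatible : ∀ m → Compatible (λ x y → y < x) (Crossing m)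
descent-crossing-compatible m x<z (m<x , z≤m) = <-irrefl refl (<-trans x<z (≤-<-trans z≤m m<x))

module _ {m : ℕ} {ys zs : List ℕ} (low : All (_≤ m) ys) (high : All (m <_) zs) where

  all-pairs : {Q : ℕ → ℕ → Set} → (∀ {y z} → y ≤ m → m < z → Q y z) → All (λ y → All (Q y) zs) ys
  all-pairs q = All.map (λ y≤m → All.map (q y≤m) high) low

  -- No descent straddles the cut, so inversions add up.
  inv-blocks : inv (ys ++ zs) ≡ inv ys + inv zs
  inv-blocks = begin
    inv (ys ++ zs)                         ≡⟨ inv≡invBy (ys ++ zs) ⟩
    invBy descent? (ys ++ zs)              ≡⟨ invBy-++ descent? ys zs (all-pairs (λ y≤m m<z z<y → <⇒≯ (≤-<-trans y≤m m<z) z<y)) ⟩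
    invBy descent? ys + invBy descent? zs  ≡⟨ sym (cong₂ _+_ (inv≡invBy ys) (inv≡invBy zs)) ⟩
    inv ys + inv zs                        ∎
    where open ≡-Reasoning

  crossings-blocks : invBy (crossing? m) (ys ++ zs) ≡ 0
  crossings-blocks = begin
    invBy (crossing? m) (ys ++ zs)
      ≡⟨ invBy-++ (crossing? m) ys zs (all-pairs (λ y≤m _ (m<y , _) → <⇒≱ m<y y≤m)) ⟩
    invBy (crossing? m) ys + invBy (crossing? m) zs
      ≡⟨ cong₂ _+_ (invBy-none (crossing? m) (λ x≤m _ (m<x , _) → <⇒≱ m<x x≤m) low)
                   (invBy-none (crossing? m) (λ _ m<y (_ , y≤m) → <⇒≱ m<y y≤m) high) ⟩
    0 ∎
    where open ≡-Reasoning

crossing-created : ∀ m h t f R {n} → length t ≡ n → All (_≤ m) (h ∷ t) → m < f →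
  1 ≤ invBy (crossing? m) (swapAt (suc n) ((h ∷ t) ++ f ∷ R))
crossing-created m h []        f R refl (h≤m ∷ []) m<f
  rewrite 𝟙-yes (crossing? m f h) (m<f , h≤m) = s≤s z≤n
crossing-created m h (h′ ∷ t) f R refl (_ ∷ low) m<f =
  ≤-trans (crossing-created m h′ t f R refl low m<f) (m≤n+m _ (count (crossing? m) h (swapAt (suc (length t)) ((h′ ∷ t) ++ f ∷ R))))

-- shuffle T l = Σ_{i+j=l} C(l,i)·T i j, via Pascal's rule: the first letter of a shuffle of
-- a word of length i with a word of length j comes from one of the two words.
shuffle : (ℕ → ℕ → ℕ) → ℕ → ℕ
shuffle T zero    = T 0 0
shuffle T (suc l) = shuffle (λ i j → T (suc i) j) l + shuffle (λ i j → T i (suc j)) l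

shuffle-cong : ∀ l {T U : ℕ → ℕ → ℕ} → (∀ i j → T i j ≡ U i j) → shuffle T l ≡ shuffle U l
shuffle-cong zero    e = e 0 0
shuffle-cong (suc l) e = cong₂ _+_ (shuffle-cong l (λ i j → e (suc i) j)) (shuffle-cong l (λ i j → e i (suc j)))

shuffle-Σ : ∀ r l (c : ℕ → ℕ) (T : ℕ → ℕ → ℕ → ℕ) →
  shuffle (λ i j → Σ< r (λ a → c a · T a i j)) l ≡ Σ< r (λ a → c a · shuffle (T a) l)
shuffle-Σ r zero    c T = refl
shuffle-Σ r (suc l) c T = begin
  shuffle (λ i j → Σ< r (λ a → c a · T a (suc i) j)) l + shuffle (λ i j → Σ< r (λ a → c a · T a i (suc j))) l
    ≡⟨ cong₂ _+_ (shuffle-Σ r l c (λ a i j → T a (suc i) j)) (shuffle-Σ r l c (λ a i j → T a i (suc j))) ⟩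
  Σ< r (λ a → c a · L a) + Σ< r (λ a → c a · R a)
    ≡⟨ sym (Σ<-+ r _ _) ⟩
  Σ< r (λ a → c a · L a + c a · R a)
    ≡⟨ Σ<-cong r (λ a → sym (*-distribˡ-+ (c a) (L a) (R a))) ⟩
  Σ< r (λ a → c a · shuffle (T a) (suc l)) ∎
  where
  open ≡-Reasoning
  L R : ℕ → ℕ
  L a = shuffle (λ i j → T a (suc i) j) l
  R a = shuffle (λ i j → T a i (suc j)) l

VanishesBelow : ℕ → ℕ → (ℕ → ℕ → ℕ) → Set
VanishesBelow a b T = ∀ i j → i < a ⊎ j < b → T i j ≡ 0

vanish-shiftˡ : ∀ a b {T} → VanishesBelow a b T → VanishesBelow (pred a) b (λ i j → T (suc i) j)
vanish-shiftˡ (suc a) b v i j (inj₁ i<a) = v (suc i) j (inj₁ (s≤s i<a))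
vanish-shiftˡ a       b v i j (inj₂ j<b) = v (suc i) j (inj₂ j<b)

vanish-shiftʳ : ∀ a b {T} → VanishesBelow a b T → VanishesBelow a (pred b) (λ i j → T i (suc j))
vanish-shiftʳ a b       v i j (inj₁ i<a) = v i (suc j) (inj₁ i<a)
vanish-shiftʳ a (suc b) v i j (inj₂ j<b) = v i (suc j) (inj₂ (s≤s j<b))

-- Every term of shuffle T l has i + j = l, so it vanishes when l < a + b.
shuffle-vanish : ∀ l a b {T} → VanishesBelow a b T → l < a + b → shuffle T l ≡ 0
shuffle-vanish zero    (suc a) b       v _ = v 0 0 (inj₁ z<s)
shuffle-vanish zero    zero    (suc b) v _ = v 0 0 (inj₂ z<s)
shuffle-vanish (suc l) a       b       v l<a+b = cong₂ _+_
  (shuffle-vanish l (pred a) b (vanish-shiftˡ a b v) (left a l<a+b))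
  (shuffle-vanish l a (pred b) (vanish-shiftʳ a b v) (right b l<a+b))
  where
  left : ∀ a → suc l < a + b → l < pred a + b
  left zero    lt = <-trans (n<1+n l) lt
  left (suc a) lt = ≤-pred lt
  right : ∀ b → suc l < a + b → l < a + pred b
  right zero    lt = <-trans (n<1+n l) lt
  right (suc b) lt = ≤-pred (subst (suc l <_) (+-suc a b) lt)

-- If T vanishes below (a, b), only the term (a, b) of shuffle T (a + b) survives:
-- shuffle T (a + b) = C(a + b, a)·T a b.
Collapses : ℕ → Set
Collapses n = ∀ a b T → a + b ≡ n → VanishesBelow a b T → shuffle T n · (a ! · b !) ≡ n ! · T a b

factorial-arith : ∀ x s A B → x · ((s · A) · B) ≡ s · (x · (A · B))
factorial-arith = solve-∀

factorial-arith′ : ∀ x s A B → x · (A · (s · B)) ≡ s · (x · (A · B))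
factorial-arith′ = solve-∀

collapse-left : ∀ n → Collapses n → ∀ a b T → a + b ≡ suc n → VanishesBelow a b T →
  shuffle (λ i j → T (suc i) j) n · (a ! · b !) ≡ a · (n ! · T a b)
collapse-left n ih zero    b T refl v =
  cong (_· _) (shuffle-vanish n 0 b (vanish-shiftˡ 0 b v) (n<1+n n))
collapse-left n ih (suc a) b T e    v = begin
  S · ((suc a · a !) · b !)  ≡⟨ factorial-arith S (suc a) (a !) (b !) ⟩
  suc a · (S · (a ! · b !))  ≡⟨ cong (suc a ·_) (ih a b _ (suc-injective e) (vanish-shiftˡ (suc a) b v)) ⟩
  suc a · (n ! · T (suc a) b) ∎
  where
  open ≡-Reasoning
  S = shuffle (λ i j → T (suc i) j) n

collapse-right : ∀ n → Collapses n → ∀ a b T → a + b ≡ suc n → VanishesBelow a b T →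
  shuffle (λ i j → T i (suc j)) n · (a ! · b !) ≡ b · (n ! · T a b)
collapse-right n ih a zero    T e v =
  cong (_· _) (shuffle-vanish n a 0 (vanish-shiftʳ a 0 v) (≤-reflexive (sym e)))
collapse-right n ih a (suc b) T e v = begin
  S · (a ! · (suc b · b !))  ≡⟨ factorial-arith′ S (suc b) (a !) (b !) ⟩
  suc b · (S · (a ! · b !))  ≡⟨ cong (suc b ·_) (ih a b _ (suc-injective (trans (sym (+-suc a b)) e)) (vanish-shiftʳ a (suc b) v)) ⟩
  suc b · (n ! · T a (suc b)) ∎
  where
  open ≡-Reasoning
  S = shuffle (λ i j → T i (suc j)) n

shuffle-collapse : ∀ n → Collapses n
shuffle-collapse zero    zero    zero    T refl v = trans (*-identityʳ (T 0 0)) (sym (+-identityʳ (T 0 0)))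
shuffle-collapse (suc n) a       b       T e    v = begin
  (L + R) · D                    ≡⟨ *-distribʳ-+ D L R ⟩
  L · D + R · D                  ≡⟨ cong₂ _+_ (collapse-left n ih a b T e v) (collapse-right n ih a b T e v) ⟩
  a · (n ! · t) + b · (n ! · t)  ≡⟨ sym (*-distribʳ-+ (n ! · t) a b) ⟩
  (a + b) · (n ! · t)            ≡⟨ cong (_· (n ! · t)) e ⟩
  suc n · (n ! · t)              ≡⟨ sym (*-assoc (suc n) (n !) t) ⟩
  suc n ! · t                    ∎
  where
  open ≡-Reasoning
  ih : Collapses n
  ih = shuffle-collapse n
  D = a ! · b !
  t = T a b
  L = shuffle (λ i j → T (suc i) j) n
  R = shuffle (λ i j → T i (suc j)) n

record Blocks (m p : ℕ) (x₁ x₂ : List ℕ) : Set where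
  constructor blocks
  field
    length₁ : length x₁ ≡ m
    length₂ : length x₂ ≡ p
    low     : All (_≤ m) x₁
    high    : All (m <_) x₂

swapˡ-blocks : ∀ {m p x₁ x₂} a → Blocks m p x₁ x₂ → Blocks m p (swapAt a x₁) x₂
swapˡ-blocks a (blocks l₁ l₂ low high) =
  blocks (trans (sym (↭.↭-length (swapAt-↭ a _))) l₁) l₂ (↭.All-resp-↭ (swapAt-↭ a _) low) high

swapʳ-blocks : ∀ {m p x₁ x₂} b → Blocks m p x₁ x₂ → Blocks m p x₁ (swapAt b x₂)
swapʳ-blocks b (blocks l₁ l₂ low high) =
  blocks l₁ (trans (sym (↭.↭-length (swapAt-↭ b _))) l₂) low (↭.All-resp-↭ (swapAt-↭ b _) high)

swapAt-++ˡ : ∀ a x₁ x₂ → a < length x₁ → swapAt a (x₁ ++ x₂) ≡ swapAt a x₁ ++ x₂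
swapAt-++ˡ zero          x₁          x₂ _         = refl
swapAt-++ˡ (suc zero)    (x ∷ y ∷ r) x₂ _         = refl
swapAt-++ˡ (suc zero)    (x ∷ [])    x₂ (s≤s ())
swapAt-++ˡ (suc (suc a)) (x ∷ r)     x₂ (s≤s a<r) = cong (x ∷_) (swapAt-++ˡ (suc a) r x₂ a<r)

swapAt-++ʳ : ∀ x₁ b x₂ → swapAt (suc (length x₁ + b)) (x₁ ++ x₂) ≡ x₁ ++ swapAt (suc b) x₂
swapAt-++ʳ []      b x₂ = refl
swapAt-++ʳ (x ∷ r) b x₂ = cong (x ∷_) (swapAt-++ʳ r b x₂)

++-injective : ∀ x₁ w₁ {x₂ w₂ : List ℕ} → length x₁ ≡ length w₁ → x₁ ++ x₂ ≡ w₁ ++ w₂ → x₁ ≡ w₁ × x₂ ≡ w₂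
++-injective []       []       _   e = refl , e
++-injective (a ∷ x₁) (b ∷ w₁) len e with ∷-injective e
... | refl , e′ with ++-injective x₁ w₁ (suc-injective len) e′
...   | refl , e₂ = refl , e₂

𝟙-++ : ∀ x₁ w₁ x₂ w₂ → length x₁ ≡ length w₁ → 𝟙 ((x₁ ++ x₂) ≟L (w₁ ++ w₂)) ≡ 𝟙 (x₁ ≟L w₁) · 𝟙 (x₂ ≟L w₂)
𝟙-++ x₁ w₁ x₂ w₂ len with x₁ ≟L w₁ | x₂ ≟L w₂
... | yes e₁ | yes e₂ = 𝟙-yes ((x₁ ++ x₂) ≟L (w₁ ++ w₂)) (cong₂ _++_ e₁ e₂)
... | no ¬e₁ | _      = 𝟙-no ((x₁ ++ x₂) ≟L (w₁ ++ w₂)) (¬e₁ ∘ proj₁ ∘ ++-injective x₁ w₁ len)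
... | yes _  | no ¬e₂ = 𝟙-no ((x₁ ++ x₂) ≟L (w₁ ++ w₂)) (¬e₂ ∘ proj₂ ∘ ++-injective x₁ w₁ len)

-- A path through the letter m (exchanging the two blocks' neighbouring entries) creates a
-- crossing that costs one more step than the budget allows, so it contributes nothing.
boundary-vanishes : ∀ m p {x₁ x₂ w₁ w₂} k r l → Blocks m p x₁ x₂ → Blocks m p w₁ w₂ →
  inv (x₁ ++ x₂) + suc l ≤ inv (w₁ ++ w₂) →
  boundary m p (λ i → (k + suc i) · paths k r l (swapAt (suc i) (x₁ ++ x₂)) (w₁ ++ w₂)) ≡ 0
boundary-vanishes zero    p       k r l _ _ _ = refl
boundary-vanishes (suc m) zero    k r l _ _ _ = refl
boundary-vanishes (suc m) (suc p) {[]}          k r l (blocks () _ _ _) _ _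
boundary-vanishes (suc m) (suc p) {_ ∷ _} {[]}  k r l (blocks _ () _ _) _ _
boundary-vanishes (suc m) (suc p) {h ∷ t} {f ∷ R} {w₁} {w₂} k r l (blocks len _ low (m<f ∷ _)) (blocks _ _ wlow whigh) budget =
  trans (cong ((k + suc m) ·_) (paths-vanish descent? C? (descent-crossing-compatible (suc m)) k r l y w gap)) (*-zeroʳ (k + suc m))
  where
  open ≤-Reasoning
  C? = crossing? (suc m)
  x = (h ∷ t) ++ f ∷ R
  y = swapAt (suc m) x
  w = w₁ ++ w₂
  gap : invBy descent? y + invBy C? w + l < invBy descent? w + invBy C? y
  gap = begin-strict
    invBy descent? y + invBy C? w + l  ≡⟨ cong₂ (λ s t → s + t + l) (sym (inv≡invBy y)) (crossings-blocks wlow whigh) ⟩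
    inv y + 0 + l                      ≡⟨ cong (_+ l) (+-identityʳ (inv y)) ⟩
    inv y + l                          ≤⟨ +-monoˡ-≤ l (inv-swapAt (suc m) x) ⟩
    inv x + 1 + l                      ≡⟨ +-assoc (inv x) 1 l ⟩
    inv x + suc l                      ≤⟨ budget ⟩
    inv w                              <⟨ m<m+n (inv w) (crossing-created (suc m) h t f R (suc-injective len) low m<f) ⟩
    inv w + invBy C? y                 ≡⟨ cong (_+ invBy C? y) (inv≡invBy w) ⟩
    invBy descent? w + invBy C? y      ∎

budget-step : ∀ a b c l → b ≤ a + 1 → a + suc l ≤ c → b + l ≤ c
budget-step a b c l b≤a+1 budget = ≤-trans (+-monoˡ-≤ l b≤a+1) (≤-trans (≤-reflexive (+-assoc a 1 l)) budget)

*-leftComm : ∀ x y z → x · (y · z) ≡ y · (x · z)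
*-leftComm = solve-∀

suc<⇐<∸1 : ∀ {a} m → a < m ∸ 1 → suc a < m
suc<⇐<∸1 (suc m) a<m = s≤s a<m

-- Path counts between block lists factorise into path counts inside the blocks, combined
-- by shuffle sums; the budget inv x + l ≤ inv w is what rules out the letter m.
module Factorisation (m p : ℕ) {w₁ w₂ : List ℕ} (w-blocks : Blocks m p w₁ w₂) where

  target : List ℕ
  target = w₁ ++ w₂

  lowPaths : ℕ → List ℕ → ℕ
  lowPaths i x₁ = paths 0 (m ∸ 1) i x₁ w₁

  highPaths : ℕ → List ℕ → ℕ
  highPaths j x₂ = paths m (p ∸ 1) j x₂ w₂

  letterTerm : ℕ → List ℕ → ℕ → ℕ
  letterTerm l x i = suc i · paths 0 (m + p ∸ 1) l (swapAt (suc i) x) target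

  Factorises : ℕ → Set
  Factorises l = ∀ {x₁ x₂} → Blocks m p x₁ x₂ → inv (x₁ ++ x₂) + l ≤ inv target →
    paths 0 (m + p ∸ 1) l (x₁ ++ x₂) target ≡ shuffle (λ i j → lowPaths i x₁ · highPaths j x₂) l

  lowLetters : ∀ l → Factorises l → ∀ {x₁ x₂} → Blocks m p x₁ x₂ → inv (x₁ ++ x₂) + suc l ≤ inv target →
    Σ< (m ∸ 1) (letterTerm l (x₁ ++ x₂)) ≡ shuffle (λ i j → lowPaths (suc i) x₁ · highPaths j x₂) l
  lowLetters l ih {x₁} {x₂} bx budget = begin
    Σ< (m ∸ 1) (letterTerm l (x₁ ++ x₂))                     ≡⟨ Σ<-cong< (m ∸ 1) term ⟩
    Σ< (m ∸ 1) (λ a → suc a · shuffle (T a) l)                ≡⟨ sym (shuffle-Σ (m ∸ 1) l suc T) ⟩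
    shuffle (λ i j → Σ< (m ∸ 1) (λ a → suc a · T a i j)) l    ≡⟨ shuffle-cong l pull ⟩
    shuffle (λ i j → lowPaths (suc i) x₁ · highPaths j x₂) l  ∎
    where
    open ≡-Reasoning
    T : ℕ → ℕ → ℕ → ℕ
    T a i j = lowPaths i (swapAt (suc a) x₁) · highPaths j x₂
    term : ∀ a → a < m ∸ 1 → letterTerm l (x₁ ++ x₂) a ≡ suc a · shuffle (T a) l
    term a a<m = cong (suc a ·_) (trans (cong (λ y → paths 0 (m + p ∸ 1) l y target) swap-eq)
      (ih (swapˡ-blocks (suc a) bx)
          (budget-step _ _ _ l (subst (λ y → inv y ≤ _) swap-eq (inv-swapAt (suc a) (x₁ ++ x₂))) budget)))
      where
      swap-eq : swapAt (suc a) (x₁ ++ x₂) ≡ swapAt (suc a) x₁ ++ x₂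
      swap-eq = swapAt-++ˡ (suc a) x₁ x₂ (subst (suc a <_) (sym (Blocks.length₁ bx)) (suc<⇐<∸1 m a<m))
    pull : ∀ i j → Σ< (m ∸ 1) (λ a → suc a · T a i j) ≡ lowPaths (suc i) x₁ · highPaths j x₂
    pull i j = trans (Σ<-cong (m ∸ 1) (λ a → sym (*-assoc (suc a) (lowPaths i (swapAt (suc a) x₁)) (highPaths j x₂))))
                     (sym (Σ<-*ʳ (m ∸ 1) (λ a → suc a · lowPaths i (swapAt (suc a) x₁)) (highPaths j x₂)))

  highLetters : ∀ l → Factorises l → ∀ {x₁ x₂} → Blocks m p x₁ x₂ → inv (x₁ ++ x₂) + suc l ≤ inv target →
    Σ< (p ∸ 1) (λ b → letterTerm l (x₁ ++ x₂) (m + b)) ≡ shuffle (λ i j → lowPaths i x₁ · highPaths (suc j) x₂) l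
  highLetters l ih {x₁} {x₂} bx budget = begin
    Σ< (p ∸ 1) (λ b → letterTerm l (x₁ ++ x₂) (m + b))             ≡⟨ Σ<-cong (p ∸ 1) term ⟩
    Σ< (p ∸ 1) (λ b → (m + suc b) · shuffle (T b) l)                ≡⟨ sym (shuffle-Σ (p ∸ 1) l (λ b → m + suc b) T) ⟩
    shuffle (λ i j → Σ< (p ∸ 1) (λ b → (m + suc b) · T b i j)) l    ≡⟨ shuffle-cong l pull ⟩
    shuffle (λ i j → lowPaths i x₁ · highPaths (suc j) x₂) l        ∎
    where
    open ≡-Reasoning
    T : ℕ → ℕ → ℕ → ℕ
    T b i j = lowPaths i x₁ · highPaths j (swapAt (suc b) x₂)
    term : ∀ b → letterTerm l (x₁ ++ x₂) (m + b) ≡ (m + suc b) · shuffle (T b) l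
    term b = cong₂ _·_ (sym (+-suc m b)) (trans (cong (λ y → paths 0 (m + p ∸ 1) l y target) swap-eq)
      (ih (swapʳ-blocks (suc b) bx)
          (budget-step _ _ _ l (subst (λ y → inv y ≤ _) swap-eq (inv-swapAt (suc (m + b)) (x₁ ++ x₂))) budget)))
      where
      swap-eq : swapAt (suc (m + b)) (x₁ ++ x₂) ≡ x₁ ++ swapAt (suc b) x₂
      swap-eq = subst (λ n → swapAt (suc (n + b)) (x₁ ++ x₂) ≡ x₁ ++ swapAt (suc b) x₂) (Blocks.length₁ bx)
                      (swapAt-++ʳ x₁ b x₂)
    pull : ∀ i j → Σ< (p ∸ 1) (λ b → (m + suc b) · T b i j) ≡ lowPaths i x₁ · highPaths (suc j) x₂
    pull i j = trans (Σ<-cong (p ∸ 1) (λ b → *-leftComm (m + suc b) (lowPaths i x₁) _))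
                     (sym (Σ<-*ˡ (p ∸ 1) (lowPaths i x₁) _))

  factorise : ∀ l → Factorises l
  factorise zero    {x₁} {x₂} bx _ =
    𝟙-++ x₁ w₁ x₂ w₂ (trans (Blocks.length₁ bx) (sym (Blocks.length₁ w-blocks)))
  factorise (suc l) {x₁} {x₂} bx budget = begin
    Σ< (m + p ∸ 1) (letterTerm l x)
      ≡⟨ Σ<-around m p (letterTerm l x) ⟩
    Σ< (m ∸ 1) (letterTerm l x) + boundary m p (letterTerm l x) + Σ< (p ∸ 1) (λ b → letterTerm l x (m + b))
      ≡⟨ cong₂ _+_ (cong₂ _+_ (lowLetters l (factorise l) bx budget)
                              (boundary-vanishes m p 0 (m + p ∸ 1) l bx w-blocks budget))
                   (highLetters l (factorise l) bx budget) ⟩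
    shuffle T₁ l + 0 + shuffle T₂ l
      ≡⟨ cong (_+ shuffle T₂ l) (+-identityʳ (shuffle T₁ l)) ⟩
    shuffle T₁ l + shuffle T₂ l ∎
    where
    open ≡-Reasoning
    x = x₁ ++ x₂
    T₁ T₂ : ℕ → ℕ → ℕ
    T₁ i j = lowPaths (suc i) x₁ · highPaths j x₂
    T₂ i j = lowPaths i x₁ · highPaths (suc j) x₂

shiftedId : ℕ → ℕ → List ℕ
shiftedId m p = applyUpTo (λ i → suc (m + i)) p

applyUpTo-+ : ∀ (f : ℕ → ℕ) m p → applyUpTo f (m + p) ≡ applyUpTo f m ++ applyUpTo (λ i → f (m + i)) p
applyUpTo-+ f zero    p = refl
applyUpTo-+ f (suc m) p = cong (f 0 ∷_) (applyUpTo-+ (f ∘ suc) m p)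

idPerm-split : ∀ m p → idPerm (m + p) ≡ idPerm m ++ shiftedId m p
idPerm-split m p = begin
  idPerm (m + p)                                ≡⟨ map-upTo suc (m + p) ⟩
  applyUpTo suc (m + p)                         ≡⟨ applyUpTo-+ suc m p ⟩
  applyUpTo suc m ++ shiftedId m p              ≡⟨ cong (_++ shiftedId m p) (sym (map-upTo suc m)) ⟩
  idPerm m ++ shiftedId m p                     ∎
  where open ≡-Reasoning

inv-increasing : ∀ (f : ℕ → ℕ) n → (∀ {i j} → i < j → f i < f j) → inv (applyUpTo f n) ≡ 0
inv-increasing f n mono = trans (inv≡invBy (applyUpTo f n)) (no-descents f n mono)
  where
  no-descents : ∀ f n → (∀ {i j} → i < j → f i < f j) → invBy descent? (applyUpTo f n) ≡ 0
  no-descents f zero    mono = refl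
  no-descents f (suc n) mono = cong₂ _+_
    (count-none descent? (f 0) (applyUpTo⁺₁ (f ∘ suc) n (λ _ → <⇒≯ (mono z<s))))
    (no-descents (f ∘ suc) n (λ i<j → mono (s≤s i<j)))

inv-idPerm : ∀ n → inv (idPerm n) ≡ 0
inv-idPerm n = trans (cong inv (map-upTo suc n)) (inv-increasing suc n s≤s)

length-idPerm : ∀ n → length (idPerm n) ≡ n
length-idPerm n = trans (length-map suc (upTo n)) (length-upTo n)

idPerm-low : ∀ n → All (_≤ n) (idPerm n)
idPerm-low n = map⁺ (applyUpTo⁺₁ id n id)

identity-blocks : ∀ m p → Blocks m p (idPerm m) (shiftedId m p)
identity-blocks m p = blocks (length-idPerm m) (length-applyUpTo _ p) (idPerm-low m)
                             (applyUpTo⁺₁ _ p (λ {i} _ → s≤s (m≤m+n m i)))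

numerator-idPerm : ∀ n → numerator (idPerm n) ≡ 1
numerator-idPerm n = begin
  numerator (idPerm n)                                         ≡⟨ numerator-paths n (idPerm n) (length-idPerm n) ⟩
  paths 0 (n ∸ 1) (inv (idPerm n)) (idPerm n) (idPerm n)        ≡⟨ cong (λ l → paths 0 (n ∸ 1) l (idPerm n) (idPerm n)) (inv-idPerm n) ⟩
  𝟙 (idPerm n ≟L idPerm n)                                     ≡⟨ 𝟙-yes (idPerm n ≟L idPerm n) refl ⟩
  1                                                            ∎
  where open ≡-Reasoning

numerator-blocks : ∀ m p {u v} → Blocks m p u v →
  numerator (u ++ v) · (inv u ! · inv v !) ≡ (inv u + inv v) ! · (numerator u · paths m (p ∸ 1) (inv v) (shiftedId m p) v)
numerator-blocks m p {u} {v} uv = begin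
  numerator (u ++ v) · (a ! · b !)
    ≡⟨ cong (_· (a ! · b !)) as-shuffle ⟩
  shuffle T (a + b) · (a ! · b !)
    ≡⟨ shuffle-collapse (a + b) a b T refl vanishes ⟩
  (a + b) ! · (lowPaths a (idPerm m) · highPaths b (shiftedId m p))
    ≡⟨ cong (λ N → (a + b) ! · (N · highPaths b (shiftedId m p))) (sym (numerator-paths m u (Blocks.length₁ uv))) ⟩
  (a + b) ! · (numerator u · highPaths b (shiftedId m p)) ∎
  where
  open ≡-Reasoning
  open Factorisation m p uv
  a = inv u
  b = inv v
  T : ℕ → ℕ → ℕ
  T i j = lowPaths i (idPerm m) · highPaths j (shiftedId m p)
  inv-uv : inv (u ++ v) ≡ a + b
  inv-uv = inv-blocks (Blocks.low uv) (Blocks.high uv)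
  as-shuffle : numerator (u ++ v) ≡ shuffle T (a + b)
  as-shuffle = begin
    numerator (u ++ v)
      ≡⟨ numerator-paths (m + p) (u ++ v) (trans (length-++ u) (cong₂ _+_ (Blocks.length₁ uv) (Blocks.length₂ uv))) ⟩
    paths 0 (m + p ∸ 1) (inv (u ++ v)) (idPerm (m + p)) (u ++ v)
      ≡⟨ cong₂ (λ l x → paths 0 (m + p ∸ 1) l x (u ++ v)) inv-uv (idPerm-split m p) ⟩
    paths 0 (m + p ∸ 1) (a + b) (idPerm m ++ shiftedId m p) (u ++ v)
      ≡⟨ factorise (a + b) (identity-blocks m p)
           (≤-reflexive (cong₂ _+_ (trans (cong inv (sym (idPerm-split m p))) (inv-idPerm (m + p))) (sym inv-uv))) ⟩
    shuffle T (a + b) ∎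
  vanishes : VanishesBelow a b T
  vanishes i j (inj₁ i<a) = cong (_· highPaths j (shiftedId m p))
    (paths-short 0 (m ∸ 1) i (idPerm m) u (subst (λ z → z + i < a) (sym (inv-idPerm m)) i<a))
  vanishes i j (inj₂ j<b) = trans (cong (lowPaths i (idPerm m) ·_)
    (paths-short m (p ∸ 1) j (shiftedId m p) v (subst (λ z → z + j < b) (sym (inv-increasing _ p (λ i<j → s≤s (+-monoʳ-< m i<j)))) j<b)))
    (*-zeroʳ (lowPaths i (idPerm m)))

numerator-oneTimes : ∀ m p {v} → Blocks m p (idPerm m) v →
  numerator (idPerm m ++ v) ≡ paths m (p ∸ 1) (inv v) (shiftedId m p) v
numerator-oneTimes m p {v} idv = *-cancelʳ-≡ N K (b !) {{b !≢0}} (begin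
  N · b !                                        ≡⟨ cong (N ·_) (sym (*-identityˡ (b !))) ⟩
  N · (0 ! · b !)                                ≡⟨ cong (λ c → N · (c ! · b !)) (sym (inv-idPerm m)) ⟩
  N · (inv (idPerm m) ! · b !)                   ≡⟨ numerator-blocks m p idv ⟩
  (inv (idPerm m) + b) ! · (numerator (idPerm m) · K)
    ≡⟨ cong₂ (λ c n → (c + b) ! · (n · K)) (inv-idPerm m) (numerator-idPerm m) ⟩
  b ! · (1 · K)                                  ≡⟨ cong (b ! ·_) (*-identityˡ K) ⟩
  b ! · K                                        ≡⟨ *-comm (b !) K ⟩
  K · b !                                        ∎)
  where
  open ≡-Reasoning
  b = inv v
  N = numerator (idPerm m ++ v)
  K = paths m (p ∸ 1) b (shiftedId m p) v

fromℚᵘ-* : ∀ p q → fromℚᵘ (p ℚᵘ.* q) ≡ fromℚᵘ p * fromℚᵘ q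
fromℚᵘ-* p q = toℚᵘ-injective
  (ℚᵘ.≃-trans (toℚᵘ-fromℚᵘ (p ℚᵘ.* q))
    (ℚᵘ.≃-sym (ℚᵘ.≃-trans (toℚᵘ-homo-* (fromℚᵘ p) (fromℚᵘ q)) (ℚᵘ.*-cong (toℚᵘ-fromℚᵘ p) (toℚᵘ-fromℚᵘ q)))))

fraction-product : ∀ x y z p q r .{{_ : NonZero p}} .{{_ : NonZero q}} .{{_ : NonZero r}} →
  x · (q · r) ≡ (y · z) · p → (ℤ.+ x) / p ≡ (ℤ.+ y) / q * ((ℤ.+ z) / r)
fraction-product x y z (suc p) (suc q) (suc r) eq =
  trans (fromℚᵘ-cong {ℚᵘ.mkℚᵘ (ℤ.+ x) p} {ℚᵘ.mkℚᵘ (ℤ.+ y) q ℚᵘ.* ℚᵘ.mkℚᵘ (ℤ.+ z) r} (ℚᵘ.*≡* eqℤ))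
        (fromℚᵘ-* (ℚᵘ.mkℚᵘ (ℤ.+ y) q) (ℚᵘ.mkℚᵘ (ℤ.+ z) r))
  where
  eqℤ : ℤ.+ x ℤ.* ℤ.+ (suc q · suc r) ≡ (ℤ.+ y ℤ.* ℤ.+ z) ℤ.* ℤ.+ suc p
  eqℤ = trans (sym (ℤ.pos-* x _))
          (trans (cong ℤ.+_ eq) (trans (ℤ.pos-* (y · z) (suc p)) (cong (ℤ._* ℤ.+ suc p) (ℤ.pos-* y z))))

Υ-blocks : ∀ m {u v} → length u ≡ m → All (_≤ m) u → All (m <_) v → Υ (u ++ v) ≡ Υ u * Υ (idPerm m ++ v)
Υ-blocks m {u} {v} len low high =
  fraction-product (numerator (u ++ v)) (numerator u) (numerator (idPerm m ++ v)) (inv (u ++ v) !) (a !) (inv (idPerm m ++ v) !)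
    {{inv (u ++ v) !≢0}} {{a !≢0}} {{inv (idPerm m ++ v) !≢0}} (begin
  numerator (u ++ v) · (a ! · inv (idPerm m ++ v) !)
    ≡⟨ cong (λ c → numerator (u ++ v) · (a ! · c !)) (trans (inv-blocks (idPerm-low m) high) (cong (_+ b) (inv-idPerm m))) ⟩
  numerator (u ++ v) · (a ! · b !)
    ≡⟨ numerator-blocks m p (blocks len refl low high) ⟩
  (a + b) ! · (numerator u · paths m (p ∸ 1) b (shiftedId m p) v)
    ≡⟨ cong (λ K → (a + b) ! · (numerator u · K)) (sym (numerator-oneTimes m p (blocks (length-idPerm m) refl (idPerm-low m) high))) ⟩
  (a + b) ! · (numerator u · numerator (idPerm m ++ v))
    ≡⟨ *-comm ((a + b) !) _ ⟩
  (numerator u · numerator (idPerm m ++ v)) · (a + b) !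
    ≡⟨ cong (λ c → (numerator u · numerator (idPerm m ++ v)) · c !) (sym (inv-blocks low high)) ⟩
  (numerator u · numerator (idPerm m ++ v)) · inv (u ++ v) ! ∎)
  where
  open ≡-Reasoning
  p = length v
  a = inv u
  b = inv v

topBlock : ℕ → ℕ → List ℕ
topBlock m b = map (λ i → m + suc i) (downFrom b)

topBlock-high : ∀ m b → All (m <_) (topBlock m b)
topBlock-high m b = map⁺ (applyDownFrom⁺₁ id b (λ _ → m<m+n m z<s))

layered-length : ∀ bs → length (layered bs) ≡ sum bs
layered-length []       = refl
layered-length (b ∷ bs) = begin
  length (layered bs ++ topBlock (sum bs) b)             ≡⟨ length-++ (layered bs) ⟩
  length (layered bs) + length (topBlock (sum bs) b)     ≡⟨ cong₂ _+_ (layered-length bs) (trans (length-map _ (downFrom b)) (length-downFrom b)) ⟩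
  sum bs + b                                             ≡⟨ +-comm (sum bs) b ⟩
  b + sum bs                                             ∎
  where open ≡-Reasoning

layered-low : ∀ bs → All (_≤ sum bs) (layered bs)
layered-low []       = []
layered-low (b ∷ bs) = ++⁺ (All.map (λ x≤s → ≤-trans x≤s (m≤n+m (sum bs) b)) (layered-low bs))
                           (map⁺ (applyDownFrom⁺₁ id b (λ i<b → ≤-trans (+-monoʳ-≤ (sum bs) i<b) (≤-reflexive (+-comm (sum bs) b)))))

proposition2p2 : (b₁ : ℕ) (bs : List ℕ) →
    Υ (layered (b₁ ∷ bs)) ≡ Υ (layered bs) * F (sum (b₁ ∷ bs) ∸ b₁) b₁
proposition2p2 b₁ bs = begin
  Υ (layered bs ++ topBlock m b₁)                   ≡⟨ Υ-blocks m (layered-length bs) (layered-low bs) (topBlock-high m b₁) ⟩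
  Υ (layered bs) * Υ (idPerm m ++ topBlock m b₁)    ≡⟨ cong (λ t → Υ (layered bs) * Υ (idPerm m ++ t)) (map-∘ (downFrom b₁)) ⟩
  Υ (layered bs) * F m b₁                           ≡⟨ cong (λ n → Υ (layered bs) * F n b₁) (sym (m+n∸m≡n b₁ m)) ⟩
  Υ (layered bs) * F (sum (b₁ ∷ bs) ∸ b₁) b₁        ∎
  where
  open ≡-Reasoning
  m = sum bs
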